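{- Let $k$ be a positive integer and $p=\lfloor \frac{2k+1}{5}\rfloor$. Then there exist $2p$ pairwise distinct integers $\alpha_1,\dots,\alpha_p,\beta_1,\dots,\beta_p\in\{1,2,\dots,k\}$ such that $\alpha_i+\beta_i=k+i$ for every $1\le i\le p$. -}

module Defs where

{-# OPTIONS --safe #-}
module Submission where

open import Defs
open import Data.Nat using (ℕ; suc; _+_; _*_; _≤_; _/_)
open import Data.Fin using (Fin; toℕ)
open import Data.Product using (Σ; _×_)
open import Relation.Binary.PropositionalEquality using (_≡_; _≢_)

open import Data.Nat using (zero; _<_; z≤n; s≤s; z<s)
open import Data.Nat.Properties
open import Data.Nat.DivMod using (m/n*n≤m)
open import Data.Nat.Tactic.RingSolver using (solve-∀)
open import Data.Fin.Properties using (toℕ-injective; toℕ<n)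
open import Data.Product using (_,_)
open import Function using (_∘_)
open import Function.Definitions using (Injective)
open import Relation.Nullary using (contradiction)
open import Relation.Binary.PropositionalEquality using (refl; sym; trans; cong; subst)

-- Write p = a + m with a = ⌈p/2⌉, m = ⌊p/2⌋ and index the pairs by n = i - 1 ∈ [0, p).
-- Put α_n = k - p + 1 + (t + m) and β_n = a + t for n = 2t, and α_n = k - p + 1 + s,
-- β_n = a + m + 1 + s for n = 2s + 1. Then α_n + β_n = k + 1 + n, the α's are exactly the
-- p largest numbers k - p + 1, ..., k, and the β's are distinct numbers in [1, a + 2m].
-- The two ranges are disjoint as soon as a + 2m + p ≤ k, which is what 5p ≤ 2k + 1 gives.

data EvenOrOdd : ℕ → Set where
  even : ∀ t → EvenOrOdd (t + t)
  odd  : ∀ s → EvenOrOdd (suc (s + s))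

evenOrOdd : ∀ n → EvenOrOdd n
evenOrOdd zero = even 0
evenOrOdd (suc n) with evenOrOdd n
... | even t = odd t
... | odd s  = subst EvenOrOdd (cong suc (+-suc s s)) (even (suc s))

interleave : (ℕ → ℕ) → (ℕ → ℕ) → ∀ {n} → EvenOrOdd n → ℕ
interleave e o (even t) = e t
interleave e o (odd s)  = o s

module _ {p : ℕ} {e o : ℕ → ℕ} where

  interleave-preserves : (P : ℕ → Set) →
    (∀ {t} → t + t < p → P (e t)) → (∀ {s} → suc (s + s) < p → P (o s)) →
    ∀ {n} (v : EvenOrOdd n) → n < p → P (interleave e o v)
  interleave-preserves _ Pe _ (even t) n<p = Pe n<p
  interleave-preserves _ _ Po (odd s)  n<p = Po n<p

  interleave-injective : Injective _≡_ _≡_ e → Injective _≡_ _≡_ o →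
    (∀ {t s} → t + t < p → suc (s + s) < p → e t ≢ o s) →
    ∀ {n n'} (v : EvenOrOdd n) (w : EvenOrOdd n') → n < p → n' < p →
    interleave e o v ≡ interleave e o w → n ≡ n'
  interleave-injective e-inj _ _ (even t) (even t') _ _ eq = cong (λ x → x + x) (e-inj eq)
  interleave-injective _ o-inj _ (odd s)  (odd s')  _ _ eq = cong (λ x → suc (x + x)) (o-inj eq)
  interleave-injective _ _ e≢o (even t) (odd s)  n<p n'<p eq = contradiction eq (e≢o n<p n'<p)
  interleave-injective _ _ e≢o (odd s)  (even t) n<p n'<p eq = contradiction (sym eq) (e≢o n'<p n<p)

DistinctPairing : ℕ → ℕ → Set
DistinctPairing k p =
    Σ (Fin p → ℕ) λ α →
    Σ (Fin p → ℕ) λ β →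
    ((i : Fin p) → (1 ≤ α i × α i ≤ k) × (1 ≤ β i × β i ≤ k))
    × ((i j : Fin p) → i ≢ j → α i ≢ α j)
    × ((i j : Fin p) → i ≢ j → β i ≢ β j)
    × ((i j : Fin p) → α i ≢ β j)
    × ((i : Fin p) → α i + β i ≡ k + suc (toℕ i))

1≤summand : ∀ {x y k n} → x + y ≡ k + suc n → x ≤ k → 1 ≤ y
1≤summand {y = suc _} _ _ = s≤s z≤n
1≤summand {x} {zero} {k} eq x≤k =
  contradiction (trans (sym (+-identityʳ x)) eq) (<⇒≢ (≤-<-trans x≤k (m<m+n k z<s)))

module Interleaving (a m g : ℕ) (m≤a : m ≤ a) (a≤1+m : a ≤ suc m) where

  p low k : ℕ
  p = a + m
  low = a + (m + m)
  k = low + p + g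

  even-index : ∀ {t} → t + t < p → t < a
  even-index 2t<p = ≰⇒> λ a≤t → <⇒≱ 2t<p (+-mono-≤ a≤t (≤-trans m≤a a≤t))

  even-index-≤m : ∀ {t} → t + t < p → t ≤ m
  even-index-≤m 2t<p = ≤-pred (≤-trans (even-index 2t<p) a≤1+m)

  odd-index : ∀ {s} → suc (s + s) < p → s < m
  odd-index 2s+1<p = ≰⇒> λ m≤s → <⇒≱ 2s+1<p (+-mono-≤ (≤-trans a≤1+m (s≤s m≤s)) m≤s)

  α-offset β-offset α β : ∀ {n} → EvenOrOdd n → ℕ
  α-offset = interleave (_+ m) (λ s → s)
  β-offset = interleave (λ t → t) (λ s → m + suc s)
  α v = low + suc (α-offset v) + g
  β v = a + β-offset v

  α-offset<p : ∀ {n} (v : EvenOrOdd n) → n < p → α-offset v < p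
  α-offset<p = interleave-preserves (_< p)
    (λ 2t<p → +-monoˡ-< m (even-index 2t<p))
    (λ 2s+1<p → <-≤-trans (odd-index 2s+1<p) (m≤n+m m a))

  β-offset≤m+m : ∀ {n} (v : EvenOrOdd n) → n < p → β-offset v ≤ m + m
  β-offset≤m+m = interleave-preserves (_≤ m + m)
    (λ 2t<p → ≤-trans (even-index-≤m 2t<p) (m≤m+n m m))
    (λ 2s+1<p → +-monoʳ-≤ m (odd-index 2s+1<p))

  low<α : ∀ {n} (v : EvenOrOdd n) → low < α v
  low<α v = ≤-trans (m<m+n low z<s) (m≤m+n _ g)

  α≤k : ∀ {n} (v : EvenOrOdd n) → n < p → α v ≤ k
  α≤k v n<p = +-monoˡ-≤ g (+-monoʳ-≤ low (α-offset<p v n<p))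

  β≤low : ∀ {n} (v : EvenOrOdd n) → n < p → β v ≤ low
  β≤low v n<p = +-monoʳ-≤ a (β-offset≤m+m v n<p)

  α-injective : ∀ {n n'} (v : EvenOrOdd n) (w : EvenOrOdd n') → n < p → n' < p →
                α v ≡ α w → n ≡ n'
  α-injective v w n<p n'<p eq =
    interleave-injective (λ {x} {y} → +-cancelʳ-≡ m x y) (λ eq → eq)
      (λ _ 2s+1<p → >⇒≢ (<-≤-trans (odd-index 2s+1<p) (m≤n+m m _)))
      v w n<p n'<p (suc-injective (+-cancelˡ-≡ low _ _ (+-cancelʳ-≡ g _ _ eq)))

  β-injective : ∀ {n n'} (v : EvenOrOdd n) (w : EvenOrOdd n') → n < p → n' < p →
                β v ≡ β w → n ≡ n'
  β-injective v w n<p n'<p eq =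
    interleave-injective (λ eq → eq) (λ {x} {y} → suc-injective ∘ +-cancelˡ-≡ m (suc x) (suc y))
      (λ 2t<p _ → <⇒≢ (≤-<-trans (even-index-≤m 2t<p) (m<m+n m z<s)))
      v w n<p n'<p (+-cancelˡ-≡ a _ _ eq)

  α+β : ∀ {n} (v : EvenOrOdd n) → α v + β v ≡ k + suc n
  α+β (even t) = even-sum low a m g t
    where
    even-sum : ∀ low a m g t → low + suc (t + m) + g + (a + t) ≡ low + (a + m) + g + suc (t + t)
    even-sum = solve-∀
  α+β (odd s) = odd-sum low a m g s
    where
    odd-sum : ∀ low a m g s →
              low + suc s + g + (a + (m + suc s)) ≡ low + (a + m) + g + suc (suc (s + s))
    odd-sum = solve-∀

  distinctPairing : DistinctPairing k p
  distinctPairing =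
      (λ i → α (at i)) , (λ i → β (at i))
    , (λ i → (≤-trans (s≤s z≤n) (low<α (at i)) , α≤k (at i) (toℕ<n i))
           , (1≤summand (α+β (at i)) (α≤k (at i) (toℕ<n i)) , β≤k i))
    , (λ i j i≢j → i≢j ∘ toℕ-injective ∘ α-injective (at i) (at j) (toℕ<n i) (toℕ<n j))
    , (λ i j i≢j → i≢j ∘ toℕ-injective ∘ β-injective (at i) (at j) (toℕ<n i) (toℕ<n j))
    , (λ i j → >⇒≢ (≤-<-trans (β≤low (at j) (toℕ<n j)) (low<α (at i))))
    , (λ i → α+β (at i))
    where
    at : (i : Fin p) → EvenOrOdd (toℕ i)
    at i = evenOrOdd (toℕ i)
    β≤k : (i : Fin p) → β (at i) ≤ k
    β≤k i = ≤-trans (β≤low (at i) (toℕ<n i)) (≤-trans (m≤m+n low p) (m≤m+n _ g))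

distinctPairing-from-room : ∀ {k} a m → m ≤ a → a ≤ suc m → a + (m + m) + (a + m) ≤ k →
                            DistinctPairing k (a + m)
distinctPairing-from-room a m m≤a a≤1+m room with g , refl ← m≤n⇒∃[o]m+o≡n room =
  Interleaving.distinctPairing a m g m≤a a≤1+m

2*m≤2*n+1⇒m≤n : ∀ {m n} → 2 * m ≤ 2 * n + 1 → m ≤ n
2*m≤2*n+1⇒m≤n {m} {n} 2m≤2n+1 =
  ≤-pred (*-cancelˡ-< 2 m (suc n) (≤-<-trans 2m≤2n+1 (≤-reflexive (double-suc n))))
  where
  double-suc : ∀ k → suc (2 * k + 1) ≡ 2 * suc k
  double-suc = solve-∀

distinctPairing : ∀ k p → p * 5 ≤ 2 * k + 1 → DistinctPairing k p
distinctPairing k p 5p≤2k+1 with evenOrOdd p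
... | even t = distinctPairing-from-room t t ≤-refl (n≤1+n t)
                 (2*m≤2*n+1⇒m≤n (subst (_≤ 2 * k + 1) (even-room t) 5p≤2k+1))
  where
  even-room : ∀ t → (t + t) * 5 ≡ 2 * (t + (t + t) + (t + t))
  even-room = solve-∀
... | odd t = distinctPairing-from-room (suc t) t (n≤1+n t) ≤-refl
                (2*m≤2*n+1⇒m≤n (≤-trans (m≤m+n _ 1) (subst (_≤ 2 * k + 1) (odd-room t) 5p≤2k+1)))
  where
  odd-room : ∀ t → suc (t + t) * 5 ≡ 2 * (suc t + (t + t) + (suc t + t)) + 1
  odd-room = solve-∀

lemma3 : (k : ℕ) → 1 ≤ k →
    Σ (Fin ((2 * k + 1) / 5) → ℕ) λ α →
    Σ (Fin ((2 * k + 1) / 5) → ℕ) λ β →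
    ((i : Fin ((2 * k + 1) / 5)) → (1 ≤ α i × α i ≤ k) × (1 ≤ β i × β i ≤ k))
    × ((i j : Fin ((2 * k + 1) / 5)) → i ≢ j → α i ≢ α j)
    × ((i j : Fin ((2 * k + 1) / 5)) → i ≢ j → β i ≢ β j)
    × ((i j : Fin ((2 * k + 1) / 5)) → α i ≢ β j)
    × ((i : Fin ((2 * k + 1) / 5)) → α i + β i ≡ k + suc (toℕ i))
lemma3 k _ = distinctPairing k ((2 * k + 1) / 5) (m/n*n≤m (2 * k + 1) 5)
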